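{- Let $k,m,r$ be integers with $1\le m<k$ and $r\le\lceil k/m\rceil$. Consider the $r$-majority bootstrap percolation process on $\mathcal{L}(n,k)$, and suppose that at some moment a set $U\subseteq[n]^2$ has the following properties: $U$ is $\ell_1$-connected; every vertex of $[n]^2$ within $\ell_1$-distance at most $32mk^2$ from $U$ is $m$-good or active; and $U$ contains an active set $S$ which is a translate of $S^k_m(0,0)$. Then eventually $U$ becomes active.
   Context: The graph $\mathcal{L}(n,k)$ (for $2k+1\le n$) has vertex set the torus $[n]^2$ (coordinates modulo $n$; subsets of $\mathbb{Z}^2$ are mapped to $[n]^2$ by reducing coordinates modulo $n$), and each vertex $v$ is joined to $v+w$ for all $w\in\{ -k,\dots,k\}\times\{ -1,1\}$. In the $r$-majority bootstrap percolation process, at each round every inactive vertex whose number of active neighbours minus number of inactive neighbours is at least $r$ becomes active; active vertices stay active. A set is active if all its vertices are active. A translate of $U\subseteq[n]^2$ is $(x,y)+U$ for some $(x,y)\in\mathbb{Z}^2$ (modulo $n$). $\mathcal{L}_1(n)$ is the $n\times n$ toroidal square lattice (vertices $(x,y),(x',y')$ adjacent iff they agree in one coordinate and differ by $\pm1$ mod $n$ in the other). The $\ell_1$-distance is graph distance in $\mathcal{L}_1(n)$, and a set is $\ell_1$-connected if it induces a connected subgraph of $\mathcal{L}_1(n)$. For $1\le m\le k$, a vertex $v$ is $m$-good if each of the four sets $v+\{1,\dots,k\}\times\{1\}$, $v+\{1,\dots,k\}\times\{ -1\}$, $v-\{1,\dots,k\}\times\{1\}$, $v-\{1,\dots,k\}\times\{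 -1\}$ contains at least $2\lceil k/m\rceil$ active vertices. For integers $a,b\ge 0$, $S^k_m(a,b)=\bigcup_{|i|\le m+a+1}[-x_i,x_i]\times\{i\}$, where $x_{m+a+1}=b$; $x_i=x_{i+1}+k$ for $m\le i\le m+a$; $x_i=x_{i+1}+i\lceil k/m\rceil$ for $0\le i\le m-1$; and $x_{ -i}=x_i$ for $0\le i\le m+a+1$. In particular $S^k_m(0,0)$ is this set with $a=b=0$. -}

module Defs where

open import Data.Nat as ℕ using (ℕ; zero; suc; NonZero; _∸_; _/_)
import Data.Nat.Properties as ℕP
open import Data.Integer as ℤ using (ℤ; +_; _%ℕ_; ∣_∣)
open import Data.Integer.DivMod using (n%ℕd<d)
open import Data.Fin using (Fin; toℕ; fromℕ<)
open import Data.Bool using (Bool; true; false; _∨_; if_then_else_)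
open import Data.Product using (_×_; _,_; Σ; ∃)
open import Data.Sum using (_⊎_)
open import Data.List using (List; []; _∷_; map; length; filter; concatMap; upTo)
open import Relation.Binary.PropositionalEquality using (_≡_)
open import Relation.Nullary using (Dec; yes; no)
open import Relation.Nullary.Decidable using (⌊_⌋)

-- ⌈ k / m ⌉ for m ≥ 1 (value at m = 0 is irrelevant)
ceilDiv : ℕ → ℕ → ℕ
ceilDiv k zero    = 0
ceilDiv k (suc m) = (k ℕ.+ m) / suc m

Vtx : ℕ → Set
Vtx n = Fin n × Fin n

red : (n : ℕ) .{{_ : NonZero n}} → ℤ → Fin n
red n z = fromℕ< (n%ℕd<d z n)

redV : (n : ℕ) .{{_ : NonZero n}} → ℤ × ℤ → Vtx n
redV n (x , y) = red n x , red n y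

_⊕_ : {n : ℕ} .{{_ : NonZero n}} → Vtx n → ℤ × ℤ → Vtx n
_⊕_ {n} (a , b) (x , y) = redV n (+ toℕ a ℤ.+ x , + toℕ b ℤ.+ y)

-- active configurations (decidable sets of active vertices)
Config : ℕ → Set
Config n = Vtx n → Bool

symRange : ℕ → List ℤ
symRange k = map (λ i → + i ℤ.- + k) (upTo (suc (k ℕ.* 2)))

posRange : ℕ → List ℤ
posRange k = map (λ i → + suc i) (upTo k)

-- neighbourhood offsets of 𝓛(n,k): {-k..k} × {-1,1}
offsets : ℕ → List (ℤ × ℤ)
offsets k = concatMap (λ x → (x , ℤ.- + 1) ∷ (x , + 1) ∷ []) (symRange k)

countActive : {n : ℕ} .{{_ : NonZero n}} → Config n → Vtx n → List (ℤ × ℤ) → ℕ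
countActive A v ws = length (filter (λ w → Data.Bool._≟_ (A (v ⊕ w)) true) ws)
  where import Data.Bool

score : {n : ℕ} .{{_ : NonZero n}} → ℕ → Config n → Vtx n → ℤ
score k A v = + a ℤ.- + (length (offsets k) ∸ a)
  where a = countActive A v (offsets k)

step : {n : ℕ} .{{_ : NonZero n}} → ℕ → ℤ → Config n → Config n
step k r A v = A v ∨ ⌊ r ℤ.≤? score k A v ⌋

iter : {n : ℕ} .{{_ : NonZero n}} → ℕ → ℤ → ℕ → Config n → Config n
iter k r zero    A = A
iter k r (suc t) A = step k r (iter k r t A)

Good : {n : ℕ} .{{_ : NonZero n}} → ℕ → ℕ → Config n → Vtx n → Set
Good k m A v =
  (2 ℕ.* ceilDiv k m ℕ.≤ countActive A v (map (λ x → (x , + 1)) (posRange k))) ×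
  (2 ℕ.* ceilDiv k m ℕ.≤ countActive A v (map (λ x → (x , ℤ.- + 1)) (posRange k))) ×
  (2 ℕ.* ceilDiv k m ℕ.≤ countActive A v (map (λ x → (ℤ.- x , ℤ.- + 1)) (posRange k))) ×
  (2 ℕ.* ceilDiv k m ℕ.≤ countActive A v (map (λ x → (ℤ.- x , + 1)) (posRange k)))

Adj₁ : {n : ℕ} .{{_ : NonZero n}} → Vtx n → Vtx n → Set
Adj₁ u v = (v ≡ u ⊕ (+ 1 , + 0)) ⊎ (v ≡ u ⊕ (ℤ.- + 1 , + 0))
         ⊎ (v ≡ u ⊕ (+ 0 , + 1)) ⊎ (v ≡ u ⊕ (+ 0 , ℤ.- + 1))

-- Near d u v : there is a walk of length ≤ d from u to v in 𝓛₁(n),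
-- i.e. the ℓ₁-distance between u and v is at most d
data Near {n : ℕ} .{{_ : NonZero n}} : ℕ → Vtx n → Vtx n → Set where
  here  : ∀ {d u} → Near d u u
  there : ∀ {d u w v} → Adj₁ u w → Near d w v → Near (suc d) u v

data ConnIn {n : ℕ} .{{_ : NonZero n}} (U : Vtx n → Set) : Vtx n → Vtx n → Set where
  here  : ∀ {u} → ConnIn U u u
  there : ∀ {u w v} → Adj₁ u w → U w → ConnIn U w v → ConnIn U u v

L1Connected : {n : ℕ} .{{_ : NonZero n}} → (Vtx n → Set) → Set
L1Connected U = ∀ u v → U u → U v → ConnIn U u v

-- the widths x_i of S^k_m(a,b): xDown k m a b d = x_{T-d}, T = m+a+1
xDown : ℕ → ℕ → ℕ → ℕ → ℕ → ℕ
xDown k m a b zero    = b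
xDown k m a b (suc d) =
  xDown k m a b d ℕ.+ (if ⌊ m ℕ.≤? i ⌋ then k else i ℕ.* ceilDiv k m)
  where i = (m ℕ.+ a ℕ.+ 1) ∸ suc d

InS : ℕ → ℕ → ℕ → ℕ → ℤ × ℤ → Set
InS k m a b (x , i) =
  (∣ i ∣ ℕ.≤ m ℕ.+ a ℕ.+ 1) × (∣ x ∣ ℕ.≤ xDown k m a b ((m ℕ.+ a ℕ.+ 1) ∸ ∣ i ∣))

_+²_ : ℤ × ℤ → ℤ × ℤ → ℤ × ℤ
(x , y) +² (x' , y') = (x ℤ.+ x' , y ℤ.+ y')

module Submission where

-- On the finite torus the r-majority process only switches vertices on, so it reaches a
-- fixed configuration F containing A (Stabilisation).  We show that the property
-- "u + S is active in F" is carried along every edge of 𝓛₁(n) inside U: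
--   * Boundary lemma: an m-good vertex just outside a row of an active translate sees at
--     least 2k + c active vertices in its two rows of neighbours, c = ⌈k/m⌉ ≥ 2; as r ≤ c
--     it is active in the fixed point F (Score, HalfRows, Boundary).
--   * Hence u + S shifts sideways by one step, slides along its middle row, and shifts up
--     or down, the new apex seeing a full row of 2k+1 active vertices (Translation).
--   * These moves only need goodness within distance 32mk² of U (Translation.radius≤);
--     ℓ₁-displacements are realised by walks in 𝓛₁(n) (Walks).
-- As U is ℓ₁-connected, the translate reaches every v ∈ U, so every v ∈ U is active in F.

module TorusArithmetic where

  open import Data.Nat as ℕ using (ℕ; zero; suc; NonZero)
  import Data.Nat.Properties as ℕP
  open import Data.Integer as ℤ using (ℤ; +_; -[1+_]; _%ℕ_; _/ℕ_; _+_; _*_; _-_)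
  open import Data.Integer.Properties
  open import Data.Integer.DivMod using (n%ℕd<d; a≡a%ℕn+[a/ℕn]*n)
  open import Data.Nat.DivMod using (m<n⇒m%n≡m)
  open import Data.Integer.Tactic.RingSolver using (solve-∀)
  open import Data.Fin using (Fin; toℕ)
  import Data.Fin.Properties as FP
  open import Data.Product using (_,_)
  open import Data.Empty using (⊥; ⊥-elim)
  open import Relation.Binary.PropositionalEquality
  open import Defs

  no-wrap : ∀ n r r' e → r ℕ.< n → + r ≡ + r' + + suc e * + n → ⊥
  no-wrap n r r' e r<n eq = ℕP.<⇒≱ r<n (begin
      n                     ≤⟨ ℕP.m≤m+n n (e ℕ.* n) ⟩
      suc e ℕ.* n           ≤⟨ ℕP.m≤n+m (suc e ℕ.* n) r' ⟩
      r' ℕ.+ suc e ℕ.* n    ≡⟨ +-injective (trans eq (trans (cong (_+_ (+ r')) (sym (pos-* (suc e) n)))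
                                                        (sym (pos-+ r' (suc e ℕ.* n))))) ⟨
      r ∎)
    where open ℕP.≤-Reasoning

  remainder-unique : ∀ n r r' q q' → r ℕ.< n → r' ℕ.< n →
    + r + q * + n ≡ + r' + q' * + n → r ≡ r'
  remainder-unique n r r' q q' r<n r'<n eq = by-difference (q' - q) shifted
    where
    shifted : + r ≡ + r' + (q' - q) * + n
    shifted = trans (move-left (+ r) q (+ n)) (trans (cong (_- q * + n) eq) (regroup (+ r') q' q (+ n)))
      where
      move-left : ∀ a b c → a ≡ a + b * c - b * c
      move-left = solve-∀
      regroup : ∀ a b c d → a + b * d - c * d ≡ a + (b - c) * d
      regroup = solve-∀
    by-difference : ∀ d → + r ≡ + r' + d * + n → r ≡ r'
    by-difference (+ zero) h = +-injective (trans h (trans (cong (_+_ (+ r')) (*-zeroˡ (+ n))) (+-identityʳ (+ r'))))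
    by-difference (+ suc e) h = ⊥-elim (no-wrap n r r' e r<n h)
    by-difference -[1+ e ] h =
      ⊥-elim (no-wrap n r' r e r'<n (trans (rearrange (+ r') (+ suc e) (+ n)) (cong (_+ + suc e * + n) (sym h))))
      where
      rearrange : ∀ a b c → a ≡ (a + (ℤ.- b) * c) + b * c
      rearrange = solve-∀

  %ℕ-+-multiple : ∀ a q n .{{_ : NonZero n}} → (a + q * + n) %ℕ n ≡ a %ℕ n
  %ℕ-+-multiple a q n = remainder-unique n _ _ ((a + q * + n) /ℕ n) (a /ℕ n + q)
      (n%ℕd<d (a + q * + n) n) (n%ℕd<d a n)
      (trans (sym (a≡a%ℕn+[a/ℕn]*n (a + q * + n) n))
        (trans (cong (_+ q * + n) (a≡a%ℕn+[a/ℕn]*n a n)) (regroup (+ (a %ℕ n)) (a /ℕ n) q (+ n))))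
    where
    regroup : ∀ r p q n → r + p * n + q * n ≡ r + (p + q) * n
    regroup = solve-∀

  red-toℕ : ∀ n .{{_ : NonZero n}} z → toℕ (red n z) ≡ z %ℕ n
  red-toℕ n z = FP.toℕ-fromℕ< _

  red-fin : ∀ n .{{_ : NonZero n}} (a : Fin n) → red n (+ toℕ a) ≡ a
  red-fin n a = FP.toℕ-injective (trans (red-toℕ n (+ toℕ a)) (m<n⇒m%n≡m (FP.toℕ<n a)))

  red-shift : ∀ n .{{_ : NonZero n}} x y → red n (+ toℕ (red n x) + y) ≡ red n (x + y)
  red-shift n x y = FP.toℕ-injective (begin
      toℕ (red n (+ toℕ (red n x) + y))       ≡⟨ red-toℕ n (+ toℕ (red n x) + y) ⟩
      (+ toℕ (red n x) + y) %ℕ n              ≡⟨ cong (λ w → (+ w + y) %ℕ n) (red-toℕ n x) ⟩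
      (+ (x %ℕ n) + y) %ℕ n                   ≡⟨ %ℕ-+-multiple (+ (x %ℕ n) + y) (x /ℕ n) n ⟨
      (+ (x %ℕ n) + y + x /ℕ n * + n) %ℕ n    ≡⟨ cong (_%ℕ n) (regroup (+ (x %ℕ n)) y (x /ℕ n) (+ n)) ⟩
      (+ (x %ℕ n) + x /ℕ n * + n + y) %ℕ n    ≡⟨ cong (λ w → (w + y) %ℕ n) (a≡a%ℕn+[a/ℕn]*n x n) ⟨
      (x + y) %ℕ n                            ≡⟨ red-toℕ n (x + y) ⟨
      toℕ (red n (x + y)) ∎)
    where
    open ≡-Reasoning
    regroup : ∀ r y q n → r + y + q * n ≡ r + q * n + y
    regroup = solve-∀

  ⊕-assoc : ∀ {n} .{{_ : NonZero n}} (u : Vtx n) a b → (u ⊕ a) ⊕ b ≡ u ⊕ (a +² b)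
  ⊕-assoc {n} (u₁ , u₂) (a₁ , a₂) (b₁ , b₂) =
    cong₂ _,_ (trans (red-shift n (+ toℕ u₁ + a₁) b₁) (cong (red n) (+-assoc (+ toℕ u₁) a₁ b₁)))
              (trans (red-shift n (+ toℕ u₂ + a₂) b₂) (cong (red n) (+-assoc (+ toℕ u₂) a₂ b₂)))

  ⊕-zero : ∀ {n} .{{_ : NonZero n}} (u : Vtx n) → u ⊕ (+ 0 , + 0) ≡ u
  ⊕-zero {n} (u₁ , u₂) = cong₂ _,_ (trans (cong (red n) (+-identityʳ (+ toℕ u₁))) (red-fin n u₁))
                                   (trans (cong (red n) (+-identityʳ (+ toℕ u₂))) (red-fin n u₂))

  redV-⊕ : ∀ n .{{_ : NonZero n}} t p → redV n t ⊕ p ≡ redV n (t +² p)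
  redV-⊕ n (t₁ , t₂) (p₁ , p₂) = cong₂ _,_ (red-shift n t₁ p₁) (red-shift n t₂ p₂)

module Counting where

  open import Data.Nat as ℕ using (ℕ; zero; suc; _+_; _∸_; _≤_; _<_; z≤n; s≤s)
  open import Data.Nat.Properties hiding (_≟_)
  open import Data.Bool using (Bool; true; false; _≟_)
  open import Data.List using (List; []; _∷_; _++_; map; length; filter; applyUpTo)
  open import Data.List.Properties using (filter-++; length-++; length-filter; applyUpTo-∷ʳ)
  open import Data.List.Membership.Propositional using (_∈_)
  open import Data.List.Relation.Unary.Any using (here; there)
  open import Function using (_∘_)
  open import Relation.Binary.PropositionalEquality

  𝟙 : Bool → ℕ
  𝟙 true  = 1
  𝟙 false = 0

  𝟙-mono : ∀ {a b} → (a ≡ true → b ≡ true) → 𝟙 a ≤ 𝟙 b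
  𝟙-mono {false} _ = z≤n
  𝟙-mono {true}  h rewrite h refl = ≤-refl

  module _ {X : Set} where

    -- The number of entries of a list satisfying a boolean test; this is the
    -- counting used by countActive in the definition of the process.
    count : (X → Bool) → List X → ℕ
    count f l = length (filter (λ w → f w ≟ true) l)

    count-∷ : ∀ f x xs → count f (x ∷ xs) ≡ 𝟙 (f x) + count f xs
    count-∷ f x xs with f x
    ... | true  = refl
    ... | false = refl

    count-mono : ∀ {f g} → (∀ x → f x ≡ true → g x ≡ true) → ∀ l → count f l ≤ count g l
    count-mono e []      = z≤n
    count-mono {f} {g} e (x ∷ l) rewrite count-∷ f x l | count-∷ g x l = +-mono-≤ (𝟙-mono (e x)) (count-mono e l)

    count-strict : ∀ {f g} → (∀ x → f x ≡ true → g x ≡ true) → ∀ {x} l → x ∈ l →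
      f x ≡ false → g x ≡ true → count f l < count g l
    count-strict {f} {g} f⊆g (y ∷ l) (here refl) fx gx rewrite count-∷ f y l | count-∷ g y l | fx | gx =
      s≤s (count-mono f⊆g l)
    count-strict {f} {g} f⊆g (y ∷ l) (there x∈l) fx gx rewrite count-∷ f y l | count-∷ g y l =
      ≤-trans (≤-reflexive (sym (+-suc (𝟙 (f y)) (count f l)))) (+-mono-≤ (𝟙-mono (f⊆g y)) (count-strict f⊆g l x∈l fx gx))

    count-++ : ∀ f xs ys → count f (xs ++ ys) ≡ count f xs + count f ys
    count-++ f xs ys = trans (cong length (filter-++ (λ w → f w ≟ true) xs ys)) (length-++ (filter (λ w → f w ≟ true) xs))

    count-≤-length : ∀ f l → count f l ≤ length l
    count-≤-length f = length-filter (λ w → f w ≟ true)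

    count-all : ∀ l → count (λ _ → true) l ≡ length l
    count-all []      = refl
    count-all (x ∷ l) = cong suc (count-all l)

  count-map : ∀ {X Y : Set} (f : Y → Bool) (h : X → Y) xs → count f (map h xs) ≡ count (f ∘ h) xs
  count-map f h []       = refl
  count-map f h (x ∷ xs) rewrite count-∷ f (h x) (map h xs) | count-∷ (f ∘ h) x xs | count-map f h xs = refl

  applyUpTo-+ : ∀ {X : Set} (f : ℕ → X) a b → applyUpTo f (a + b) ≡ applyUpTo f a ++ applyUpTo (λ i → f (a + i)) b
  applyUpTo-+ f zero    b = refl
  applyUpTo-+ f (suc a) b = cong (f 0 ∷_) (applyUpTo-+ (f ∘ suc) a b)

  count-congUpTo : ∀ {X Y : Set} (h : X → Bool) (h' : Y → Bool) (f : ℕ → X) (g : ℕ → Y) k →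
    (∀ i → i < k → h (f i) ≡ h' (g i)) → count h (applyUpTo f k) ≡ count h' (applyUpTo g k)
  count-congUpTo h h' f g zero    e = refl
  count-congUpTo h h' f g (suc k) e
    rewrite count-∷ h (f 0) (applyUpTo (f ∘ suc) k) | count-∷ h' (g 0) (applyUpTo (g ∘ suc) k)
          | e 0 (s≤s z≤n) | count-congUpTo h h' (f ∘ suc) (g ∘ suc) k (λ i i<k → e (suc i) (s≤s i<k)) = refl

  count-reverse : ∀ {X : Set} (h : X → Bool) (f : ℕ → X) k →
    count h (applyUpTo f k) ≡ count h (applyUpTo (λ i → f (k ∸ suc i)) k)
  count-reverse h f zero    = refl
  count-reverse h f (suc k) = begin
      count h (applyUpTo f (suc k))                               ≡⟨ cong (count h) (applyUpTo-∷ʳ f k) ⟨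
      count h (applyUpTo f k ++ f k ∷ [])                         ≡⟨ count-++ h (applyUpTo f k) (f k ∷ []) ⟩
      count h (applyUpTo f k) + count h (f k ∷ [])               ≡⟨ cong₂ _+_ (count-reverse h f k) (count-∷ h (f k) []) ⟩
      count h (applyUpTo reversed k) + (𝟙 (h (f k)) + 0)         ≡⟨ cong (count h (applyUpTo reversed k) +_) (+-identityʳ _) ⟩
      count h (applyUpTo reversed k) + 𝟙 (h (f k))               ≡⟨ +-comm (count h (applyUpTo reversed k)) _ ⟩
      𝟙 (h (f k)) + count h (applyUpTo reversed k)               ≡⟨ count-∷ h (f k) (applyUpTo reversed k) ⟨
      count h (applyUpTo (λ i → f (suc k ∸ suc i)) (suc k)) ∎
    where
    open ≡-Reasoning
    reversed : ℕ → _
    reversed i = f (k ∸ suc i)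

  count-segment : ∀ {X : Set} (h : X → Bool) (f : ℕ → X) k p L → p + L ≤ k →
    (∀ i → p ≤ i → i < p + L → h (f i) ≡ true) → L ≤ count h (applyUpTo f k)
  count-segment h f k       p       zero    _  _ = z≤n
  count-segment h f zero    p       (suc L) pL _ with () ← ≤-trans (m≤n+m (suc L) p) pL
  count-segment h f (suc k) zero    (suc L) (s≤s pL) e
    rewrite count-∷ h (f 0) (applyUpTo (f ∘ suc) k) | e 0 z≤n (s≤s z≤n) =
    s≤s (count-segment h (f ∘ suc) k zero L pL (λ i _ i<L → e (suc i) z≤n (s≤s i<L)))
  count-segment h f (suc k) (suc p) (suc L) (s≤s pL) e
    rewrite count-∷ h (f 0) (applyUpTo (f ∘ suc) k) =
    ≤-trans (count-segment h (f ∘ suc) k p (suc L) pL (λ i p≤i i<pL → e (suc i) (s≤s p≤i) (s≤s i<pL)))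
            (m≤n+m _ (𝟙 (h (f 0))))

module Score where

  open import Data.Nat as ℕ using (ℕ; suc; _∸_; NonZero)
  import Data.Nat.Properties as ℕP
  open import Data.Integer as ℤ using (ℤ; +_; _+_; -_; _-_)
  import Data.Integer.Properties as ℤP
  open import Data.Integer.Tactic.RingSolver using () renaming (solve-∀ to ℤsolve)
  open import Data.Nat.Tactic.RingSolver using () renaming (solve-∀ to ℕsolve)
  open import Data.Bool using (Bool; true; false)
  open import Data.List using ([]; _∷_; _++_; map; length; applyUpTo; upTo; concatMap)
  open import Data.List.Properties using (length-map; length-applyUpTo)
  open import Data.Product using (_×_; _,_)
  open import Function using (_∘_)
  open import Relation.Binary.PropositionalEquality
  open import Relation.Nullary using (yes; no)
  open import Data.Empty using (⊥-elim)
  open import Defs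
  open Counting

  count-offsets : ∀ (F : ℤ × ℤ → Bool) xs →
    count F (concatMap (λ x → (x , - + 1) ∷ (x , + 1) ∷ []) xs)
      ≡ count (λ x → F (x , - + 1)) xs ℕ.+ count (λ x → F (x , + 1)) xs
  count-offsets F []       = refl
  count-offsets F (x ∷ xs) = begin
      count F ((x , - + 1) ∷ (x , + 1) ∷ rest)                  ≡⟨ count-∷ F _ _ ⟩
      𝟙 (F (x , - + 1)) ℕ.+ count F ((x , + 1) ∷ rest)         ≡⟨ cong (𝟙 (F (x , - + 1)) ℕ.+_) (count-∷ F _ _) ⟩
      𝟙 (F (x , - + 1)) ℕ.+ (𝟙 (F (x , + 1)) ℕ.+ count F rest)
        ≡⟨ cong (λ z → 𝟙 (F (x , - + 1)) ℕ.+ (𝟙 (F (x , + 1)) ℕ.+ z)) (count-offsets F xs) ⟩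
      𝟙 (F (x , - + 1)) ℕ.+ (𝟙 (F (x , + 1)) ℕ.+ (count down xs ℕ.+ count up xs))
        ≡⟨ interchange (𝟙 (F (x , - + 1))) (𝟙 (F (x , + 1))) (count down xs) (count up xs) ⟩
      (𝟙 (F (x , - + 1)) ℕ.+ count down xs) ℕ.+ (𝟙 (F (x , + 1)) ℕ.+ count up xs)
        ≡⟨ cong₂ ℕ._+_ (count-∷ down x xs) (count-∷ up x xs) ⟨
      count down (x ∷ xs) ℕ.+ count up (x ∷ xs) ∎
    where
    open ≡-Reasoning
    rest = concatMap (λ x → (x , - + 1) ∷ (x , + 1) ∷ []) xs
    down = λ x → F (x , - + 1)
    up   = λ x → F (x , + 1)
    interchange : ∀ a b c d → a ℕ.+ (b ℕ.+ (c ℕ.+ d)) ≡ (a ℕ.+ c) ℕ.+ (b ℕ.+ d)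
    interchange = ℕsolve

  count-symRange : ∀ (G : ℤ → Bool) k →
    count G (symRange k) ≡ count (G ∘ -_) (posRange k) ℕ.+ (𝟙 (G (+ 0)) ℕ.+ count G (posRange k))
  count-symRange G k = begin
      count G (map centred (upTo (suc (k ℕ.* 2))))
        ≡⟨ count-map G centred (upTo (suc (k ℕ.* 2))) ⟩
      count (G ∘ centred) (applyUpTo (λ i → i) (suc (k ℕ.* 2)))
        ≡⟨ cong (λ N → count (G ∘ centred) (applyUpTo (λ i → i) N)) (twice-plus-one k) ⟩
      count (G ∘ centred) (applyUpTo (λ i → i) (k ℕ.+ suc k))
        ≡⟨ cong (count (G ∘ centred)) (applyUpTo-+ (λ i → i) k (suc k)) ⟩
      count (G ∘ centred) (applyUpTo (λ i → i) k ++ applyUpTo (k ℕ.+_) (suc k))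
        ≡⟨ count-++ (G ∘ centred) (applyUpTo (λ i → i) k) (applyUpTo (k ℕ.+_) (suc k)) ⟩
      count (G ∘ centred) (applyUpTo (λ i → i) k) ℕ.+ count (G ∘ centred) (applyUpTo (k ℕ.+_) (suc k))
        ≡⟨ cong₂ ℕ._+_ negative (trans (count-∷ (G ∘ centred) (k ℕ.+ 0) _) (cong₂ ℕ._+_ (cong (𝟙 ∘ G) (centred-+ 0)) positive)) ⟩
      count (G ∘ -_) (posRange k) ℕ.+ (𝟙 (G (+ 0)) ℕ.+ count G (posRange k)) ∎
    where
    open ≡-Reasoning
    twice-plus-one : ∀ k → suc (k ℕ.* 2) ≡ k ℕ.+ suc k
    twice-plus-one = ℕsolve
    centred : ℕ → ℤ
    centred i = + i - + k
    centred-+ : ∀ j → centred (k ℕ.+ j) ≡ + j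
    centred-+ j = trans (cong (_- + k) (ℤP.pos-+ k j)) (cancel (+ k) (+ j))
      where cancel : ∀ a b → a + b - a ≡ b
            cancel = ℤsolve
    centred-∸ : ∀ i → i ℕ.< k → centred (k ∸ suc i) ≡ - + suc i
    centred-∸ i i<k = trans (ℤP.m-n≡m⊖n (k ∸ suc i) k)
      (trans (ℤP.⊖-≤ (ℕP.m∸n≤m k (suc i))) (cong (λ z → - + z) (ℕP.m∸[m∸n]≡n i<k)))
    negative : count (G ∘ centred) (applyUpTo (λ i → i) k) ≡ count (G ∘ -_) (posRange k)
    negative = trans (count-reverse (G ∘ centred) (λ i → i) k)
      (trans (count-congUpTo (G ∘ centred) (λ i → G (- + suc i)) (λ i → k ∸ suc i) (λ i → i) k
                (λ i i<k → cong G (centred-∸ i i<k)))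
             (sym (count-map (G ∘ -_) (λ i → + suc i) (upTo k))))
    positive : count (G ∘ centred) (applyUpTo (λ i → k ℕ.+ suc i) k) ≡ count G (posRange k)
    positive = trans (count-congUpTo (G ∘ centred) (λ i → G (+ suc i)) (λ i → k ℕ.+ suc i) (λ i → i) k
                        (λ i _ → cong G (centred-+ (suc i))))
                     (sym (count-map G (λ i → + suc i) (upTo k)))

  length-posRange : ∀ k → length (posRange k) ≡ k
  length-posRange k = trans (length-map (λ i → + suc i) (upTo k)) (length-applyUpTo (λ i → i) k)

  module _ {n : ℕ} .{{_ : NonZero n}} where

    rightHalf leftHalf : ℕ → Config n → Vtx n → ℤ → ℕ
    rightHalf k B v ρ = count (λ x → B (v ⊕ (x , ρ))) (posRange k)
    leftHalf  k B v ρ = count (λ x → B (v ⊕ (- x , ρ))) (posRange k)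

    rowCount : ℕ → Config n → Vtx n → ℤ → ℕ
    rowCount k B v ρ = leftHalf k B v ρ ℕ.+ (𝟙 (B (v ⊕ (+ 0 , ρ))) ℕ.+ rightHalf k B v ρ)

    countActive-rows : ∀ k (B : Config n) v →
      countActive B v (offsets k) ≡ rowCount k B v (- + 1) ℕ.+ rowCount k B v (+ 1)
    countActive-rows k B v = trans (count-offsets (λ w → B (v ⊕ w)) (symRange k))
      (cong₂ ℕ._+_ (count-symRange (λ x → B (v ⊕ (x , - + 1))) k) (count-symRange (λ x → B (v ⊕ (x , + 1))) k))

  length-offsets : ∀ k → length (offsets k) ≡ 2 ℕ.* (2 ℕ.* k ℕ.+ 1)
  length-offsets k = begin
      length (offsets k)                                                  ≡⟨ count-all (offsets k) ⟨
      count (λ _ → true) (offsets k)                                      ≡⟨ count-offsets (λ _ → true) (symRange k) ⟩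
      count (λ _ → true) (symRange k) ℕ.+ count (λ _ → true) (symRange k) ≡⟨ cong₂ ℕ._+_ row row ⟩
      (k ℕ.+ (1 ℕ.+ k)) ℕ.+ (k ℕ.+ (1 ℕ.+ k))                            ≡⟨ two-rows k ⟩
      2 ℕ.* (2 ℕ.* k ℕ.+ 1) ∎
    where
    open ≡-Reasoning
    half = trans (count-all (posRange k)) (length-posRange k)
    row : count (λ _ → true) (symRange k) ≡ k ℕ.+ (1 ℕ.+ k)
    row = trans (count-symRange (λ _ → true) k) (cong₂ (λ a b → a ℕ.+ (1 ℕ.+ b)) half half)
    two-rows : ∀ k → (k ℕ.+ (1 ℕ.+ k)) ℕ.+ (k ℕ.+ (1 ℕ.+ k)) ≡ 2 ℕ.* (2 ℕ.* k ℕ.+ 1)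
    two-rows = ℕsolve

  score-≥ : ∀ a L c → (L ∸ a) ℕ.+ c ℕ.≤ a → + c ℤ.≤ + a - + (L ∸ a)
  score-≥ a L c h = subst (+ c ℤ.≤_) (sym (trans (ℤP.m-n≡m⊖n a (L ∸ a)) (ℤP.⊖-≥ (ℕP.m+n≤o⇒m≤o (L ∸ a) h))))
    (ℤ.+≤+ (ℕP.m+n≤o⇒m≤o∸n c (subst (ℕ._≤ a) (ℕP.+-comm (L ∸ a) c) h)))

  inactive-few : ∀ k c a → 2 ℕ.≤ c → a ℕ.≤ 2 ℕ.* (2 ℕ.* k ℕ.+ 1) → 2 ℕ.* k ℕ.+ c ℕ.≤ a →
    (2 ℕ.* (2 ℕ.* k ℕ.+ 1) ∸ a) ℕ.+ c ℕ.≤ a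
  inactive-few k c a c≥2 a≤L h = ℕP.+-cancelʳ-≤ a _ _ (begin
      (L ∸ a) ℕ.+ c ℕ.+ a                  ≡⟨ swap (L ∸ a) c a ⟩
      (L ∸ a) ℕ.+ a ℕ.+ c                  ≡⟨ cong (ℕ._+ c) (ℕP.m∸n+n≡m a≤L) ⟩
      L ℕ.+ c                              ≡⟨ expand k c ⟩
      2 ℕ.* (2 ℕ.* k) ℕ.+ 2 ℕ.+ c          ≤⟨ ℕP.+-monoˡ-≤ c (ℕP.+-monoʳ-≤ (2 ℕ.* (2 ℕ.* k)) c≥2) ⟩
      2 ℕ.* (2 ℕ.* k) ℕ.+ c ℕ.+ c          ≡⟨ regroup k c ⟩
      (2 ℕ.* k ℕ.+ c) ℕ.+ (2 ℕ.* k ℕ.+ c)  ≤⟨ ℕP.+-mono-≤ h h ⟩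
      a ℕ.+ a ∎)
    where
    open ℕP.≤-Reasoning
    L = 2 ℕ.* (2 ℕ.* k ℕ.+ 1)
    swap : ∀ x y z → x ℕ.+ y ℕ.+ z ≡ x ℕ.+ z ℕ.+ y
    swap = ℕsolve
    expand : ∀ k c → 2 ℕ.* (2 ℕ.* k ℕ.+ 1) ℕ.+ c ≡ 2 ℕ.* (2 ℕ.* k) ℕ.+ 2 ℕ.+ c
    expand = ℕsolve
    regroup : ∀ k c → 2 ℕ.* (2 ℕ.* k) ℕ.+ c ℕ.+ c ≡ (2 ℕ.* k ℕ.+ c) ℕ.+ (2 ℕ.* k ℕ.+ c)
    regroup = ℕsolve

  step-activates : ∀ {n} .{{_ : NonZero n}} k c (r : ℤ) (B : Config n) v → r ℤ.≤ + c → 2 ℕ.≤ c →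
    2 ℕ.* k ℕ.+ c ℕ.≤ rowCount k B v (- + 1) ℕ.+ rowCount k B v (+ 1) → step k r B v ≡ true
  step-activates k c r B v r≤c c≥2 rich with B v
  ... | true  = refl
  ... | false with r ℤP.≤? score k B v
  ...   | yes _   = refl
  ...   | no r≰s = ⊥-elim (r≰s (ℤP.≤-trans r≤c (subst (λ L → + c ℤ.≤ + a - + (L ∸ a)) (sym (length-offsets k))
                     (score-≥ a _ c (inactive-few k c a c≥2 a≤L a-rich)))))
    where
    a = countActive B v (offsets k)
    a≤L : a ℕ.≤ 2 ℕ.* (2 ℕ.* k ℕ.+ 1)
    a≤L = subst (a ℕ.≤_) (length-offsets k) (count-≤-length (λ w → B (v ⊕ w)) (offsets k))
    a-rich : 2 ℕ.* k ℕ.+ c ℕ.≤ a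
    a-rich = subst (2 ℕ.* k ℕ.+ c ℕ.≤_) (sym (countActive-rows k B v)) rich

module Stabilisation where

  open import Data.Nat as ℕ using (ℕ; zero; suc; NonZero; z≤n; s≤s)
  import Data.Nat.Properties as ℕP
  open import Data.Integer using (ℤ)
  open import Data.Bool using (true; false)
  import Data.Bool as Bool
  open import Data.List using (List; length; cartesianProduct; allFin)
  open import Data.List.Membership.Propositional using (_∈_; find)
  open import Data.List.Membership.Propositional.Properties using (∈-cartesianProduct⁺; ∈-allFin)
  open import Data.List.Relation.Unary.All using (all?)
  import Data.List.Relation.Unary.All as All
  open import Data.List.Relation.Unary.All.Properties using (¬All⇒Any¬)
  open import Data.Product using (_×_; _,_; ∃)
  open import Data.Sum using (_⊎_; inj₁; inj₂)
  open import Relation.Binary.PropositionalEquality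
  open import Relation.Nullary using (yes; no; ¬_)
  open import Data.Empty using (⊥-elim)
  open import Defs
  open Counting using (count; count-strict; count-≤-length)

  became-active : ∀ {x y} → (x ≡ true → y ≡ true) → ¬ (y ≡ x) → (x ≡ false) × (y ≡ true)
  became-active {false} {false} _ y≢x = ⊥-elim (y≢x refl)
  became-active {false} {true}  _ _   = refl , refl
  became-active {true}          x⇒y y≢x = ⊥-elim (y≢x (x⇒y refl))

  module _ {n : ℕ} .{{_ : NonZero n}} (k : ℕ) (r : ℤ) where

    step-inflationary : ∀ (B : Config n) v → B v ≡ true → step k r B v ≡ true
    step-inflationary B v h rewrite h = refl

    iter-inflationary : ∀ t (A : Config n) v → A v ≡ true → iter k r t A v ≡ true
    iter-inflationary zero    A v h = h
    iter-inflationary (suc t) A v h = step-inflationary (iter k r t A) v (iter-inflationary t A v h)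

    allVtx : List (Vtx n)
    allVtx = cartesianProduct (allFin n) (allFin n)

    ∈-allVtx : ∀ (v : Vtx n) → v ∈ allVtx
    ∈-allVtx (a , b) = ∈-cartesianProduct⁺ (∈-allFin a) (∈-allFin b)

    Stable : Config n → ℕ → Set
    Stable A τ = ∀ v → step k r (iter k r τ A) v ≡ iter k r τ A v

    grows-or-stops : ∀ A j → (j ℕ.≤ count (iter k r j A) allVtx) ⊎ ∃ (Stable A)
    grows-or-stops A zero = inj₁ z≤n
    grows-or-stops A (suc j) with grows-or-stops A j
    ... | inj₂ stopped = inj₂ stopped
    ... | inj₁ grown with all? (λ v → step k r (iter k r j A) v Bool.≟ iter k r j A v) allVtx
    ...   | yes unchanged = inj₂ (j , λ v → All.lookup unchanged (∈-allVtx v))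
    ...   | no changed with find (¬All⇒Any¬ (λ v → step k r (iter k r j A) v Bool.≟ iter k r j A v) allVtx changed)
    ...     | v , v∈ , differs with became-active (step-inflationary (iter k r j A) v) differs
    ...       | was-inactive , now-active =
      inj₁ (ℕP.≤-trans (s≤s grown) (count-strict (step-inflationary (iter k r j A)) allVtx v∈ was-inactive now-active))

    stabilises : ∀ A → ∃ (Stable A)
    stabilises A with grows-or-stops A (suc (length allVtx))
    ... | inj₂ stopped = stopped
    ... | inj₁ grown   = ⊥-elim (ℕP.<⇒≱ (s≤s (count-≤-length (iter k r (suc (length allVtx)) A) allVtx)) grown)

module Shape where

  open import Data.Nat as ℕ using (ℕ; zero; suc; _+_; _*_; _∸_; _≤_; _<_; z≤n; s≤s; _%_; _≤′_; ≤′-refl; ≤′-step)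
  open import Data.Nat.Properties
  open import Data.Nat.DivMod using (m≡m%n+[m/n]*n; m%n<n; m/n*n≤m; m*n/n≡m; /-monoˡ-≤)
  open import Data.Bool using (if_then_else_)
  open import Relation.Binary.PropositionalEquality
  open import Relation.Nullary using (yes; no)
  open import Relation.Nullary.Decidable using (⌊_⌋)
  open import Data.Empty using (⊥-elim)
  open import Defs
  open import Data.Nat.Tactic.RingSolver using (solve-∀)

  module Widths (k m' : ℕ) (m<k : suc m' < k) where
    m = suc m'
    c = ceilDiv k m

    k≤c*m : k ≤ c * m
    k≤c*m = +-cancelʳ-≤ m' k (c * m) (begin
        k + m'                  ≡⟨ m≡m%n+[m/n]*n (k + m') m ⟩
        (k + m') % m + c * m    ≤⟨ +-monoˡ-≤ (c * m) (ℕ.s≤s⁻¹ (m%n<n (k + m') m)) ⟩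
        m' + c * m              ≡⟨ +-comm m' (c * m) ⟩
        c * m + m' ∎)
      where open ≤-Reasoning

    c*m≤k+m' : c * m ≤ k + m'
    c*m≤k+m' = m/n*n≤m (k + m') m

    -- Since m < k, c ≥ 2; this makes 2k + c active neighbours (out of 2(2k+1)) enough to activate.
    c≥2 : 2 ≤ c
    c≥2 = subst (_≤ c) (m*n/n≡m 2 m) (/-monoˡ-≤ m (begin
        2 * m        ≡⟨ double m' ⟩
        suc m + m'   ≤⟨ +-monoˡ-≤ m' m<k ⟩
        k + m' ∎))
      where open ≤-Reasoning
            double : ∀ x → 2 * suc x ≡ suc (suc x) + x
            double = solve-∀

    T : ℕ
    T = m + 0 + 1

    T≡ : T ≡ suc m
    T≡ = trans (cong (_+ 1) (+-identityʳ m)) (+-comm m 1)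

    -- X i = x_i, the half-width of row i; slope i = x_i - x_{i+1}.
    X : ℕ → ℕ
    X i = xDown k m 0 0 (T ∸ i)

    slope : ℕ → ℕ
    slope i = if ⌊ m ≤? i ⌋ then k else i * c

    X-step : ∀ i → i < T → X i ≡ X (suc i) + slope i
    X-step i i<T = trans (cong (xDown k m 0 0) T∸i) (cong (λ j → X (suc i) + slope j) T∸[T∸i])
      where
      T∸i : T ∸ i ≡ suc (T ∸ suc i)
      T∸i = +-∸-assoc 1 i<T
      T∸[T∸i] : T ∸ suc (T ∸ suc i) ≡ i
      T∸[T∸i] = trans (cong (T ∸_) (sym T∸i)) (m∸[m∸n]≡n (<⇒≤ i<T))

    slope-below : ∀ i → i < m → slope i ≡ i * c
    slope-below i i<m with m ≤? i
    ... | yes m≤i = ⊥-elim (<⇒≱ i<m m≤i)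
    ... | no  _   = refl

    slope-at : slope m ≡ k
    slope-at with m ≤? m
    ... | yes _   = refl
    ... | no  m≰m = ⊥-elim (m≰m ≤-refl)

    X-top : X T ≡ 0
    X-top = cong (xDown k m 0 0) (n∸n≡0 T)

    X-m : X m ≡ k
    X-m = trans (X-step m (subst (m <_) (sym T≡) ≤-refl))
                (cong₂ _+_ (trans (cong X (sym T≡)) X-top) slope-at)

    below-T : ∀ {i} → i ≤ m → i < T
    below-T {i} i≤m = subst (i <_) (sym T≡) (s≤s i≤m)

    X-antitone : ∀ {i j} → i ≤ j → j ≤ T → X j ≤ X i
    X-antitone i≤j = antitone (≤⇒≤′ i≤j)
      where
      antitone : ∀ {i j} → i ≤′ j → j ≤ T → X j ≤ X i
      antitone ≤′-refl          _   = ≤-refl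
      antitone (≤′-step {j} i≤j) j<T =
        ≤-trans (subst (X (suc j) ≤_) (sym (X-step j j<T)) (m≤m+n _ _)) (antitone i≤j (<⇒≤ j<T))

    k≤X : ∀ {i} → i ≤ m → k ≤ X i
    k≤X {i} i≤m = subst (_≤ X i) X-m (X-antitone i≤m (subst (m ≤_) (sym T≡) (n≤1+n m)))

    X-flat : X 0 ≡ X 1
    X-flat = trans (X-step 0 (subst (0 <_) (sym T≡) (s≤s z≤n)))
                   (trans (cong (X 1 +_) (slope-below 0 (s≤s z≤n))) (+-identityʳ (X 1)))

    drop-growth : ∀ j → j < m → X (suc j) ∸ X (suc (suc j)) ≤ (X j ∸ X (suc j)) + c
    drop-growth j j<m = begin
        X (suc j) ∸ X (suc (suc j))   ≡⟨ drop (suc j) (below-T j<m) ⟩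
        slope (suc j)                 ≤⟨ slope≤ ⟩
        suc j * c                     ≡⟨ trans (+-comm c (j * c)) (cong (_+ c) (sym (slope-below j j<m))) ⟩
        slope j + c                   ≡⟨ cong (_+ c) (drop j (below-T (<⇒≤ j<m))) ⟨
        (X j ∸ X (suc j)) + c ∎
      where
      open ≤-Reasoning
      drop : ∀ i → i < T → X i ∸ X (suc i) ≡ slope i
      drop i i<T = trans (cong (_∸ X (suc i)) (X-step i i<T)) (m+n∸m≡n (X (suc i)) (slope i))
      slope≤ : slope (suc j) ≤ suc j * c
      slope≤ with m ≤? suc j
      ... | yes m≤ = ≤-trans k≤c*m (≤-reflexive (trans (*-comm c m) (cong (_* c) (≤-antisym m≤ j<m))))
      ... | no  _  = ≤-refl

    -- Each slope is at most 2k (since c·m ≤ k + m - 1 < 2k).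
    slope≤2k : ∀ i → slope i ≤ 2 * k
    slope≤2k i with m ≤? i
    ... | yes _ = m≤m+n k (k + 0)
    ... | no m≰i = begin
        i * c   ≤⟨ *-monoˡ-≤ c (<⇒≤ (≰⇒> m≰i)) ⟩
        m * c   ≡⟨ *-comm m c ⟩
        c * m   ≤⟨ c*m≤k+m' ⟩
        k + m'  ≤⟨ +-monoʳ-≤ k (≤-trans (n≤1+n m') (<⇒≤ m<k)) ⟩
        k + k   ≡⟨ cong (k +_) (+-identityʳ k) ⟨
        2 * k ∎
      where open ≤-Reasoning

    X₀≤ : X 0 ≤ T * (2 * k)
    X₀≤ = widths T
      where
      widths : ∀ d → xDown k m 0 0 d ≤ d * (2 * k)
      widths zero    = z≤n
      widths (suc d) = ≤-trans (+-mono-≤ (widths d) (slope≤2k (T ∸ suc d))) (≤-reflexive (+-comm (d * (2 * k)) (2 * k)))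

module HalfRows where

  open import Data.Nat as ℕ using (ℕ; zero; suc; _∸_; _⊓_; NonZero; z≤n; s≤s)
  import Data.Nat.Properties as ℕP
  open import Data.Integer as ℤ using (ℤ; +_; -[1+_]; _+_; -_; _⊖_; ∣_∣)
  import Data.Integer.Properties as ℤP
  open import Data.Bool using (true)
  open import Data.List using (upTo)
  open import Data.Product using (_,_)
  open import Data.Sum using (inj₁; inj₂)
  open import Relation.Binary.PropositionalEquality
  open import Relation.Nullary using (yes; no)
  open import Defs
  open import Data.Nat.Tactic.RingSolver using (solve-∀)
  open Counting using (count; count-map; count-segment; 𝟙)
  open TorusArithmetic using (⊕-assoc)
  open Score using (rowCount; leftHalf; rightHalf)

  -- The two sides of the translate: the vertex just outside row y of u + S on
  -- side σ is u + (±(a+1), y) where a is the half-width of that row.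
  data Side : Set where
    right left : Side

  outside : Side → ℕ → ℤ
  outside right a = + suc a
  outside left  a = -[1+ a ]

  toward away : Side → ℤ → ℤ
  toward right x = - x
  toward left  x = x
  away   right x = x
  away   left  x = - x

  ∣outside∣ : ∀ σ a → ∣ outside σ a ∣ ≡ suc a
  ∣outside∣ right a = refl
  ∣outside∣ left  a = refl

  ∣outside-toward∣ : ∀ σ a j → ∣ outside σ a + toward σ (+ suc j) ∣ ≡ ∣ a ⊖ j ∣
  ∣outside-toward∣ right a j = cong ∣_∣ (ℤP.[1+m]⊖[1+n]≡m⊖n a j)
  ∣outside-toward∣ left  a j = trans (cong ∣_∣ (ℤP.[1+m]⊖[1+n]≡m⊖n j a)) (ℤP.∣m⊖n∣≡∣n⊖m∣ j a)

  ∣outside-away∣ : ∀ σ a j → ∣ outside σ a + away σ (+ suc j) ∣ ≡ suc a ℕ.+ suc j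
  ∣outside-away∣ right a j = refl
  ∣outside-away∣ left  a j = cong suc (sym (ℕP.+-suc a j))

  ∣⊖∣≤ : ∀ a j D → a ℕ.≤ j ℕ.+ D → j ℕ.≤ a ℕ.+ D → ∣ a ⊖ j ∣ ℕ.≤ D
  ∣⊖∣≤ a j D h₁ h₂ with a ℕ.≤? j
  ... | yes a≤j = subst (ℕ._≤ D) (sym (ℤP.∣⊖∣-≤ a≤j)) (ℕP.m≤n+o⇒m∸n≤o j a h₂)
  ... | no  a≰j = subst (ℕ._≤ D) (sym (trans (ℤP.∣m⊖n∣≡∣n⊖m∣ a j) (ℤP.∣⊖∣-< (ℕP.≰⇒> a≰j))))
                        (ℕP.m≤n+o⇒m∸n≤o a j h₁)

  module RowBounds {n : ℕ} .{{_ : NonZero n}} (k m : ℕ) (F : Config n) where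

    SActive : Vtx n → Set
    SActive u = ∀ p → InS k m 0 0 p → F (u ⊕ p) ≡ true

    T : ℕ
    T = m ℕ.+ 0 ℕ.+ 1

    width : ℕ → ℕ
    width i = xDown k m 0 0 (T ∸ i)

    towardCount awayCount : Side → Vtx n → ℤ → ℕ
    towardCount σ v ρ = count (λ x → F (v ⊕ (toward σ x , ρ))) (posRange k)
    awayCount   σ v ρ = count (λ x → F (v ⊕ (away σ x , ρ))) (posRange k)

    centre : Vtx n → ℤ → ℕ
    centre v ρ = 𝟙 (F (v ⊕ (+ 0 , ρ)))

    rowCount-split : ∀ σ v ρ → rowCount k F v ρ ≡ towardCount σ v ρ ℕ.+ (centre v ρ ℕ.+ awayCount σ v ρ)
    rowCount-split right v ρ = refl
    rowCount-split left  v ρ = mirror (leftHalf k F v ρ) (centre v ρ) (rightHalf k F v ρ)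
      where mirror : ∀ a b c → a ℕ.+ (b ℕ.+ c) ≡ c ℕ.+ (b ℕ.+ a)
            mirror = solve-∀

    inRow : ∀ x y ρ {i'} → ∣ y + ρ ∣ ≡ i' → i' ℕ.≤ T → ∣ x ∣ ℕ.≤ width i' → InS k m 0 0 (x , y + ρ)
    inRow x y ρ refl i'≤T x≤ = i'≤T , x≤

    segment : ∀ u xv y ρ (g : ℤ → ℤ) p L → p ℕ.+ L ℕ.≤ k → SActive u →
      (∀ j → p ℕ.≤ j → j ℕ.< p ℕ.+ L → InS k m 0 0 (xv + g (+ suc j) , y + ρ)) →
      L ℕ.≤ count (λ x → F ((u ⊕ (xv , y)) ⊕ (g x , ρ))) (posRange k)
    segment u xv y ρ g p L p+L≤k active inS =
      subst (L ℕ.≤_) (sym (count-map (λ x → F ((u ⊕ (xv , y)) ⊕ (g x , ρ))) (λ i → + suc i) (upTo k)))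
        (count-segment (λ x → F ((u ⊕ (xv , y)) ⊕ (g (+ suc x) , ρ))) (λ i → i) k p L p+L≤k
          (λ j p≤j j<p+L → trans (cong F (⊕-assoc u (xv , y) (g (+ suc j) , ρ)))
                                 (active (xv + g (+ suc j) , y + ρ) (inS j p≤j j<p+L))))

    beside : Side → Vtx n → ℕ → ℤ → Vtx n
    beside σ u a y = u ⊕ (outside σ a , y)

    toward-segment : ∀ σ u a y ρ {i'} p L → ∣ y + ρ ∣ ≡ i' → i' ℕ.≤ T → p ℕ.+ L ℕ.≤ k →
      a ℕ.≤ p ℕ.+ width i' → p ℕ.+ L ℕ.≤ suc (a ℕ.+ width i') → SActive u →
      L ℕ.≤ towardCount σ (beside σ u a y) ρ
    toward-segment σ u a y ρ {i'} p L row i'≤T p+L≤k h₁ h₂ active =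
      segment u (outside σ a) y ρ (toward σ) p L p+L≤k active λ j p≤j j<p+L →
        inRow (outside σ a + toward σ (+ suc j)) y ρ row i'≤T
          (subst (ℕ._≤ width i') (sym (∣outside-toward∣ σ a j))
            (∣⊖∣≤ a j (width i') (ℕP.≤-trans h₁ (ℕP.+-monoˡ-≤ (width i') p≤j)) (ℕP.≤-pred (ℕP.≤-trans j<p+L h₂))))

    away-segment : ∀ σ u a y ρ {i'} L → ∣ y + ρ ∣ ≡ i' → i' ℕ.≤ T → L ℕ.≤ k →
      suc a ℕ.+ L ℕ.≤ width i' → SActive u → L ℕ.≤ awayCount σ (beside σ u a y) ρ
    away-segment σ u a y ρ {i'} L row i'≤T L≤k h active =
      segment u (outside σ a) y ρ (away σ) 0 L L≤k active λ j _ j<L →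
        inRow (outside σ a + away σ (+ suc j)) y ρ row i'≤T
          (subst (ℕ._≤ width i') (sym (∣outside-away∣ σ a j)) (ℕP.≤-trans (ℕP.+-monoʳ-≤ (suc a) j<L) h))

    centre-in : ∀ σ u a y ρ {i'} → ∣ y + ρ ∣ ≡ i' → i' ℕ.≤ T → suc a ℕ.≤ width i' → SActive u →
      1 ℕ.≤ centre (beside σ u a y) ρ
    centre-in σ u a y ρ {i'} row i'≤T h active =
      subst (λ b → 1 ℕ.≤ 𝟙 b) (sym (trans (cong F (⊕-assoc u (outside σ a , y) (+ 0 , ρ)))
        (active (outside σ a + + 0 , y + ρ)
          (inRow (outside σ a + + 0) y ρ row i'≤T
            (subst (ℕ._≤ width i') (sym (trans (cong ∣_∣ (ℤP.+-identityʳ (outside σ a))) (∣outside∣ σ a))) h)))))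
        ℕP.≤-refl

    toward-bound : ∀ σ u a y ρ {i'} → ∣ y + ρ ∣ ≡ i' → i' ℕ.≤ T → k ℕ.≤ a ℕ.+ width i' → SActive u →
      k ∸ (a ∸ width i') ℕ.≤ towardCount σ (beside σ u a y) ρ
    toward-bound σ u a y ρ {i'} row i'≤T k≤a+D active with ℕP.≤-total (a ∸ width i') k
    ... | inj₁ p≤k = toward-segment σ u a y ρ (a ∸ width i') (k ∸ (a ∸ width i')) row i'≤T
          (ℕP.≤-reflexive (ℕP.m+[n∸m]≡n p≤k)) (ℕP.≤-trans (ℕP.m≤n+m∸n a (width i')) (ℕP.≤-reflexive (ℕP.+-comm (width i') _)))
          (ℕP.≤-trans (ℕP.≤-reflexive (ℕP.m+[n∸m]≡n p≤k)) (ℕP.≤-trans k≤a+D (ℕP.n≤1+n _))) active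
    ... | inj₂ k≤p = ℕP.≤-trans (ℕP.≤-reflexive (ℕP.m≤n⇒m∸n≡0 k≤p)) z≤n

    centre-away-bound : ∀ σ u a y ρ {i'} → ∣ y + ρ ∣ ≡ i' → i' ℕ.≤ T → SActive u →
      k ⊓ (width i' ∸ a) ℕ.≤ centre (beside σ u a y) ρ ℕ.+ awayCount σ (beside σ u a y) ρ
    centre-away-bound σ u a y ρ {i'} row i'≤T active = by-excess (width i' ∸ a) refl
      where
      D = width i'
      ⊓-suc : ∀ k e → k ⊓ suc e ℕ.≤ suc (k ⊓ e)
      ⊓-suc zero    e = z≤n
      ⊓-suc (suc k) e = s≤s (ℕP.⊓-monoˡ-≤ e (ℕP.n≤1+n k))
      by-excess : ∀ e → D ∸ a ≡ e → k ⊓ e ℕ.≤ centre (beside σ u a y) ρ ℕ.+ awayCount σ (beside σ u a y) ρ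
      by-excess zero    _  = ℕP.≤-trans (ℕP.m⊓n≤n k 0) z≤n
      by-excess (suc e) eq = ℕP.≤-trans (⊓-suc k e)
          (ℕP.+-mono-≤ (centre-in σ u a y ρ row i'≤T (ℕP.≤-trans (ℕP.m≤m+n (suc a) e) fits) active)
                       (away-segment σ u a y ρ (k ⊓ e) row i'≤T (ℕP.m⊓n≤m k e)
                          (ℕP.≤-trans (ℕP.+-monoʳ-≤ (suc a) (ℕP.m⊓n≤n k e)) fits) active))
        where
        fits : suc a ℕ.+ e ℕ.≤ D
        fits = ℕP.≤-reflexive (trans (sym (ℕP.+-suc a e)) (trans (cong (a ℕ.+_) (sym eq))
                 (ℕP.m+[n∸m]≡n {a} (ℕP.<⇒≤ (ℕP.m∸n≢0⇒n<m (λ z → ℕP.0≢1+n (trans (sym z) eq)))))))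

module Boundary where

  open import Data.Nat as ℕ using (ℕ; zero; suc; _∸_; _⊓_; NonZero; z≤n; s≤s; _*_)
  import Data.Nat.Properties as ℕP
  open import Data.Integer as ℤ using (ℤ; +_; -[1+_]; _+_; -_; ∣_∣)
  import Data.Integer.Properties as ℤP
  open import Data.Bool using (true)
  open import Data.List using (map; upTo)
  open import Data.Product using (_,_)
  open import Data.Sum using (_⊎_; inj₁; inj₂)
  open import Relation.Binary.PropositionalEquality
  open import Relation.Nullary using (yes; no)
  open import Defs
  open import Data.Nat.Tactic.RingSolver using (solve-∀)
  open import Data.Integer.Tactic.RingSolver using () renaming (solve-∀ to ℤsolve)
  open Counting using (count-map; count-mono; count-segment; 𝟙)
  open Score using (rowCount; step-activates)
  open HalfRows using (right; left; module RowBounds)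

  data Row : Set where
    above below : Row

  ρ : Row → ℤ
  ρ above = + 1
  ρ below = - + 1

  flip : Row → Row
  flip above = below
  flip below = above

  ρ-flip : ∀ R y → ρ R + y + ρ (flip R) ≡ y
  ρ-flip above = ℤsolve
  ρ-flip below = ℤsolve

  both-rows : ∀ R (f : ℤ → ℕ) → f (- + 1) ℕ.+ f (+ 1) ≡ f (ρ (flip R)) ℕ.+ f (ρ R)
  both-rows above f = refl
  both-rows below f = ℕP.+-comm (f (- + 1)) (f (+ 1))

  -- Row index of the neighbouring row nearer to the middle row 0 (for row 0 itself: row ±1).
  inner : ℕ → ℕ
  inner zero    = 1
  inner (suc i) = i

  record InnerOuter (y : ℤ) : Set where
    field
      rIn rOut : Row
      ∣in∣  : ∣ y + ρ rIn ∣ ≡ inner ∣ y ∣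
      ∣out∣ : ∣ y + ρ rOut ∣ ≡ suc ∣ y ∣
      sorted : ∀ (f : ℤ → ℕ) → f (- + 1) ℕ.+ f (+ 1) ≡ f (ρ rIn) ℕ.+ f (ρ rOut)

  inner-outer : ∀ y → InnerOuter y
  inner-outer (+ zero)  = record { rIn = below ; rOut = above ; ∣in∣ = refl ; ∣out∣ = refl ; sorted = λ f → refl }
  inner-outer (+ suc j) = record
    { rIn = below ; rOut = above
    ; ∣in∣ = cong ∣_∣ (ℤP.[1+m]⊖[1+n]≡m⊖n j 0) ; ∣out∣ = cong suc (ℕP.+-comm j 1) ; sorted = λ f → refl }
  inner-outer -[1+ j ]  = record
    { rIn = above ; rOut = below
    ; ∣in∣ = trans (cong ∣_∣ (ℤP.[1+m]⊖[1+n]≡m⊖n 0 j)) (ℤP.∣m⊖n∣≡∣n⊖m∣ 0 j)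
    ; ∣out∣ = cong (λ z → suc (suc z)) (ℕP.+-identityʳ j) ; sorted = λ f → ℕP.+-comm (f (- + 1)) (f (+ 1)) }

  -- The inequality closing the count for a vertex beside rows 0, …, m: with
  -- d = x_{i-1} - x_i and s = x_i - x_{i+1} ≤ d + c, the inner row yields k + min(k, d)
  -- and the outer row (k - s) + 2c active neighbours, in total at least 2k + c.
  enough-neighbours : ∀ k c d s → s ℕ.≤ d ℕ.+ c → 2 * k ℕ.+ c ℕ.≤ (k ℕ.+ k ⊓ d) ℕ.+ ((k ∸ s) ℕ.+ 2 * c)
  enough-neighbours k c d s s≤d+c with ℕP.≤-total k d
  ... | inj₁ k≤d rewrite ℕP.m≤n⇒m⊓n≡m k≤d = ℕP.≤-trans (ℕP.≤-reflexive (double k c))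
        (ℕP.+-monoʳ-≤ (k ℕ.+ k) (ℕP.≤-trans (ℕP.m≤n+m c c) (ℕP.≤-trans (ℕP.≤-reflexive (sym (two c))) (ℕP.m≤n+m _ (k ∸ s)))))
    where double : ∀ k c → 2 * k ℕ.+ c ≡ (k ℕ.+ k) ℕ.+ c
          double = solve-∀
          two : ∀ c → 2 * c ≡ c ℕ.+ c
          two = solve-∀
  ... | inj₂ d≤k rewrite ℕP.m≥n⇒m⊓n≡n d≤k = begin
      2 * k ℕ.+ c                                 ≡⟨ regroup k c ⟩
      k ℕ.+ k ℕ.+ c                               ≤⟨ ℕP.+-monoˡ-≤ c (ℕP.+-monoʳ-≤ k (ℕP.m≤n+m∸n k (d ℕ.+ c))) ⟩
      k ℕ.+ ((d ℕ.+ c) ℕ.+ (k ∸ (d ℕ.+ c))) ℕ.+ c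
        ≤⟨ ℕP.+-monoˡ-≤ c (ℕP.+-monoʳ-≤ k (ℕP.+-monoʳ-≤ (d ℕ.+ c) (ℕP.∸-monoʳ-≤ k s≤d+c))) ⟩
      k ℕ.+ ((d ℕ.+ c) ℕ.+ (k ∸ s)) ℕ.+ c          ≡⟨ regroup′ k d c (k ∸ s) ⟩
      (k ℕ.+ d) ℕ.+ ((k ∸ s) ℕ.+ 2 * c) ∎
    where
    open ℕP.≤-Reasoning
    regroup : ∀ k c → 2 * k ℕ.+ c ≡ k ℕ.+ k ℕ.+ c
    regroup = solve-∀
    regroup′ : ∀ k d c t → k ℕ.+ ((d ℕ.+ c) ℕ.+ t) ℕ.+ c ≡ (k ℕ.+ d) ℕ.+ (t ℕ.+ 2 * c)
    regroup′ = solve-∀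

  module Activation {n : ℕ} .{{_ : NonZero n}} (k m' : ℕ) (m<k : suc m' ℕ.< k)
         (r : ℤ) (r≤c : r ℤ.≤ + ceilDiv k (suc m'))
         (A F : Config n) (A⊆F : ∀ v → A v ≡ true → F v ≡ true) (fixed : ∀ v → step k r F v ≡ F v) where

    open Shape.Widths k m' m<k public
    open RowBounds k (suc m') F public hiding (T)

    good-away : ∀ {v} → Good k m A v → ∀ σ R → 2 * c ℕ.≤ awayCount σ v (ρ R)
    good-away {v} (g₁ , g₂ , g₃ , g₄) = λ where
        right above → lift (λ x → (x , + 1)) g₁
        right below → lift (λ x → (x , - + 1)) g₂
        left  below → lift (λ x → (- x , - + 1)) g₃
        left  above → lift (λ x → (- x , + 1)) g₄
      where
      lift : ∀ h → 2 * c ℕ.≤ countActive A v (map h (posRange k)) →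
             2 * c ℕ.≤ Counting.count (λ x → F (v ⊕ h x)) (posRange k)
      lift h g = ℕP.≤-trans (subst (2 * c ℕ.≤_) (count-map (λ w → A (v ⊕ w)) h (posRange k)) g)
                            (count-mono (λ x → A⊆F (v ⊕ h x)) (posRange k))

    rich-active : ∀ v R R' → (∀ (f : ℤ → ℕ) → f (- + 1) ℕ.+ f (+ 1) ≡ f (ρ R) ℕ.+ f (ρ R')) →
      2 * k ℕ.+ c ℕ.≤ rowCount k F v (ρ R) ℕ.+ rowCount k F v (ρ R') → F v ≡ true
    rich-active v R R' sorted rich = trans (sym (fixed v))
      (step-activates k c r F v r≤c c≥2 (subst (2 * k ℕ.+ c ℕ.≤_) (sym (sorted (rowCount k F v))) rich))

    GoodOrActive : Vtx n → Set
    GoodOrActive v = Good k m A v ⊎ A v ≡ true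

    row-in-S : ∀ σ u a y R {i'} → ∣ y + ρ R ∣ ≡ i' → i' ℕ.≤ T → k ℕ.≤ a ℕ.+ X i' → SActive u →
      (k ∸ (a ∸ X i')) ℕ.+ k ⊓ (X i' ∸ a) ℕ.≤ rowCount k F (beside σ u a y) (ρ R)
    row-in-S σ u a y R row i'≤T k≤ active = ℕP.≤-trans
      (ℕP.+-mono-≤ (toward-bound σ u a y (ρ R) row i'≤T k≤ active) (centre-away-bound σ u a y (ρ R) row i'≤T active))
      (ℕP.≤-reflexive (sym (rowCount-split σ (beside σ u a y) (ρ R))))

    row-in-S-good : ∀ σ u a y R {i'} → ∣ y + ρ R ∣ ≡ i' → i' ℕ.≤ T → k ℕ.≤ a ℕ.+ X i' → SActive u →
      Good k m A (beside σ u a y) → (k ∸ (a ∸ X i')) ℕ.+ 2 * c ℕ.≤ rowCount k F (beside σ u a y) (ρ R)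
    row-in-S-good σ u a y R row i'≤T k≤ active g = ℕP.≤-trans
      (ℕP.+-mono-≤ (toward-bound σ u a y (ρ R) row i'≤T k≤ active)
                   (ℕP.≤-trans (good-away g σ R) (ℕP.m≤n+m _ (centre (beside σ u a y) (ρ R)))))
      (ℕP.≤-reflexive (sym (rowCount-split σ (beside σ u a y) (ρ R))))

    row-good : ∀ σ v R → Good k m A v → 2 * c ℕ.≤ rowCount k F v (ρ R)
    row-good σ v R g = subst (2 * c ℕ.≤_) (sym (rowCount-split σ v (ρ R)))
      (ℕP.≤-trans (ℕP.≤-trans (good-away g σ R) (ℕP.m≤n+m _ (centre v (ρ R)))) (ℕP.m≤n+m _ (towardCount σ v (ρ R))))

    inner≤m : ∀ i → i ℕ.≤ m → inner i ℕ.≤ m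
    inner≤m zero    _   = s≤s z≤n
    inner≤m (suc i) i<m = ℕP.<⇒≤ i<m

    X≤X-inner : ∀ i → i ℕ.≤ m → X i ℕ.≤ X (inner i)
    X≤X-inner zero    _   = ℕP.≤-reflexive X-flat
    X≤X-inner (suc i) i<m = X-antitone (ℕP.n≤1+n i) (ℕP.<⇒≤ (below-T i<m))

    drop≤ : ∀ i → i ℕ.≤ m → X i ∸ X (suc i) ℕ.≤ (X (inner i) ∸ X i) ℕ.+ c
    drop≤ zero    _   = ℕP.≤-trans (ℕP.≤-reflexive (trans (cong (_∸ X 1) X-flat) (ℕP.n∸n≡0 (X 1)))) z≤n
    drop≤ (suc j) j<m = drop-growth j j<m

    -- Core estimate: beside a row i ≤ m, an m-good vertex sees k + min(k, x_{i-1} - x_i)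
    -- active vertices in the inner row and (k - (x_i - x_{i+1})) + 2c in the outer one.
    beside-middle-active : ∀ σ u y i → ∣ y ∣ ≡ i → i ℕ.≤ m → SActive u →
      Good k m A (beside σ u (X i) y) → F (beside σ u (X i) y) ≡ true
    beside-middle-active σ u y i refl i≤m active g =
      rich-active v rIn rOut sorted (ℕP.≤-trans (enough-neighbours k c _ _ (drop≤ i i≤m)) (ℕP.+-mono-≤ in-row out-row))
      where
      open InnerOuter (inner-outer y)
      v = beside σ u (X i) y
      in-row : k ℕ.+ k ⊓ (X (inner i) ∸ X i) ℕ.≤ rowCount k F v (ρ rIn)
      in-row = subst (λ t → t ℕ.+ k ⊓ (X (inner i) ∸ X i) ℕ.≤ rowCount k F v (ρ rIn))
        (cong (k ∸_) (ℕP.m≤n⇒m∸n≡0 (X≤X-inner i i≤m)))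
        (row-in-S σ u (X i) y rIn ∣in∣ (ℕP.<⇒≤ (below-T (inner≤m i i≤m)))
          (ℕP.≤-trans (k≤X (inner≤m i i≤m)) (ℕP.m≤n+m _ (X i))) active)
      out-row : (k ∸ (X i ∸ X (suc i))) ℕ.+ 2 * c ℕ.≤ rowCount k F v (ρ rOut)
      out-row = row-in-S-good σ u (X i) y rOut ∣out∣ (below-T i≤m) (ℕP.≤-trans (k≤X i≤m) (ℕP.m≤m+n _ _)) active g

    -- Beside the top row (x_T = 0) the inner row m is full: 2k active neighbours there.
    beside-top-active : ∀ σ u y → ∣ y ∣ ≡ suc m → SActive u →
      Good k m A (beside σ u (X (suc m)) y) → F (beside σ u (X (suc m)) y) ≡ true
    beside-top-active σ u y e active g = rich-active v rIn rOut sorted (begin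
        2 * k ℕ.+ c                                                ≤⟨ ℕP.+-monoʳ-≤ (2 * k) (ℕP.m≤n+m c c) ⟩
        2 * k ℕ.+ (c ℕ.+ c)                                        ≡⟨ regroup k c ⟩
        (k ℕ.+ k) ℕ.+ 2 * c
          ≡⟨ cong₂ (λ a b → (a ℕ.+ b) ℕ.+ 2 * c) toward-full centre-away-full ⟨
        ((k ∸ (X (suc m) ∸ X m)) ℕ.+ k ⊓ (X m ∸ X (suc m))) ℕ.+ 2 * c ≤⟨ ℕP.+-mono-≤ in-row (row-good σ v rOut g) ⟩
        rowCount k F v (ρ rIn) ℕ.+ rowCount k F v (ρ rOut) ∎)
      where
      open ℕP.≤-Reasoning
      open InnerOuter (inner-outer y)
      v = beside σ u (X (suc m)) y
      X-outermost : X (suc m) ≡ 0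
      X-outermost = trans (cong X (sym T≡)) X-top
      toward-full : k ∸ (X (suc m) ∸ X m) ≡ k
      toward-full rewrite X-outermost = cong (k ∸_) (ℕP.0∸n≡0 (X m))
      centre-away-full : k ⊓ (X m ∸ X (suc m)) ≡ k
      centre-away-full rewrite X-outermost | X-m = ℕP.⊓-idem k
      regroup : ∀ k c → 2 * k ℕ.+ (c ℕ.+ c) ≡ (k ℕ.+ k) ℕ.+ 2 * c
      regroup = solve-∀
      in-row = row-in-S σ u (X (suc m)) y rIn (trans ∣in∣ (cong inner e)) (ℕP.<⇒≤ (below-T ℕP.≤-refl))
                 (ℕP.≤-trans (k≤X ℕP.≤-refl) (ℕP.m≤n+m _ (X (suc m)))) active

    beside-active : ∀ σ u y → ∣ y ∣ ℕ.≤ T → SActive u →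
      GoodOrActive (beside σ u (X ∣ y ∣) y) → F (beside σ u (X ∣ y ∣) y) ≡ true
    beside-active σ u y _   _      (inj₂ a) = A⊆F _ a
    beside-active σ u y y≤T active (inj₁ g) = by-row ∣ y ∣ refl y≤T g
      where
      by-row : ∀ i → ∣ y ∣ ≡ i → i ℕ.≤ T → Good k m A (beside σ u (X i) y) → F (beside σ u (X i) y) ≡ true
      by-row i e i≤T g with i ℕ.≤? m
      ... | yes i≤m = beside-middle-active σ u y i e i≤m active g
      ... | no  i≰m with ℕP.≤-antisym (subst (i ℕ.≤_) T≡ i≤T) (ℕP.≰⇒> i≰m)
      ...   | refl = beside-top-active σ u y e active g

    row-full : ∀ v ρ' → (∀ z → ∣ z ∣ ℕ.≤ k → F (v ⊕ (z , ρ')) ≡ true) → k ℕ.+ (1 ℕ.+ k) ℕ.≤ rowCount k F v ρ'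
    row-full v ρ' full = ℕP.+-mono-≤ (half -_ (λ j → ℤP.∣-i∣≡∣i∣ (+ suc j))) (ℕP.+-mono-≤ centre-on (half (λ x → x) (λ j → refl)))
      where
      half : ∀ (g : ℤ → ℤ) → (∀ j → ∣ g (+ suc j) ∣ ≡ suc j) →
        k ℕ.≤ Counting.count (λ x → F (v ⊕ (g x , ρ'))) (posRange k)
      half g ∣g∣ = subst (k ℕ.≤_) (sym (count-map (λ x → F (v ⊕ (g x , ρ'))) (λ i → + suc i) (upTo k)))
        (count-segment (λ x → F (v ⊕ (g (+ suc x) , ρ'))) (λ i → i) k 0 k ℕP.≤-refl
          (λ j _ j<k → full (g (+ suc j)) (ℕP.≤-trans (ℕP.≤-reflexive (∣g∣ j)) j<k)))
      centre-on : 1 ℕ.≤ 𝟙 (F (v ⊕ (+ 0 , ρ')))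
      centre-on = subst (λ b → 1 ℕ.≤ 𝟙 b) (sym (full (+ 0) z≤n)) ℕP.≤-refl

    apex-active : ∀ v R → (∀ z → ∣ z ∣ ℕ.≤ k → F (v ⊕ (z , ρ (flip R))) ≡ true) → GoodOrActive v → F v ≡ true
    apex-active v R full (inj₂ a) = A⊆F v a
    apex-active v R full (inj₁ g) = rich-active v (flip R) R (both-rows R)
      (ℕP.≤-trans (ℕP.≤-trans (ℕP.m≤m+n (2 * k ℕ.+ c) (1 ℕ.+ c)) (ℕP.≤-reflexive (regroup k c)))
                  (ℕP.+-mono-≤ (row-full v (ρ (flip R)) full) (row-good right v R g)))
      where
      regroup : ∀ k c → 2 * k ℕ.+ c ℕ.+ (1 ℕ.+ c) ≡ k ℕ.+ (1 ℕ.+ k) ℕ.+ 2 * c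
      regroup = solve-∀

module Translation where

  open import Data.Nat as ℕ using (ℕ; zero; suc; NonZero; z≤n; s≤s)
  import Data.Nat.Properties as ℕP
  open import Data.Integer as ℤ using (ℤ; +_; -[1+_]; _+_; -_; ∣_∣)
  import Data.Integer.Properties as ℤP
  open import Data.Bool using (true)
  open import Data.Product using (_,_; proj₁; proj₂)
  open import Data.Sum using (inj₁; inj₂)
  open import Relation.Binary.PropositionalEquality
  open import Relation.Nullary using (yes; no; ¬_)
  open import Data.Empty using (⊥-elim)
  open import Defs
  open import Data.Nat.Tactic.RingSolver using (solve-∀)
  open TorusArithmetic using (⊕-assoc; ⊕-zero)
  open HalfRows using (Side; right; left; outside)
  open Boundary using (above; below; ρ; flip; ρ-flip; module Activation)

  unit : Side → ℤ
  unit right = + 1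
  unit left  = - + 1

  steps : Side → ℕ → ℤ
  steps right s = + s
  steps left  s = - + s

  steps-suc : ∀ σ s → steps σ s + unit σ ≡ steps σ (suc s)
  steps-suc right s = trans (sym (ℤP.pos-+ s 1)) (cong +_ (ℕP.+-comm s 1))
  steps-suc left  s = trans (sym (ℤP.neg-distrib-+ (+ s) (+ 1))) (cong (λ z → - + z) (ℕP.+-comm s 1))

  ∣steps∣ : ∀ σ s → ∣ steps σ s ∣ ≡ s
  ∣steps∣ right s = refl
  ∣steps∣ left  s = ℤP.∣-i∣≡∣i∣ (+ s)

  step-out : ∀ σ x a → ∣ x ∣ ℕ.≤ a → ¬ (∣ unit σ + x ∣ ℕ.≤ a) → unit σ + x ≡ outside σ a
  step-out right (+ b)      a b≤a out = cong (λ z → + suc z) (ℕP.≤-antisym b≤a (ℕP.≤-pred (ℕP.≰⇒> out)))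
  step-out right -[1+ b ]   a b<a out = ⊥-elim (out (subst (ℕ._≤ a) (sym ∣1-[1+b]∣) (ℕP.≤-trans (ℕP.n≤1+n b) b<a)))
    where ∣1-[1+b]∣ : ∣ + 1 + -[1+ b ] ∣ ≡ b
          ∣1-[1+b]∣ = trans (cong ∣_∣ (ℤP.[1+m]⊖[1+n]≡m⊖n 0 b)) (ℤP.∣⊖∣-≤ z≤n)
  step-out left  -[1+ b ]   a b<a out = cong -[1+_] (ℕP.≤-antisym b<a (ℕP.≤-pred (ℕP.≰⇒> out)))
  step-out left  (+ zero)   a _   out = cong -[1+_] (ℕP.≤-antisym z≤n (ℕP.≤-pred (ℕP.≰⇒> out)))
  step-out left  (+ suc b)  a b<a out = ⊥-elim (out (subst (ℕ._≤ a) (sym (cong ∣_∣ (ℤP.[1+m]⊖[1+n]≡m⊖n b 0)))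
                                                    (ℕP.≤-trans (ℕP.n≤1+n b) b<a)))

  module Moves {n : ℕ} .{{_ : NonZero n}} (k m' : ℕ) (m<k : suc m' ℕ.< k)
         (r : ℤ) (r≤c : r ℤ.≤ + ceilDiv k (suc m'))
         (A F : Config n) (A⊆F : ∀ v → A v ≡ true → F v ≡ true) (fixed : ∀ v → step k r F v ≡ F v) where

    open Activation k m' m<k r r≤c A F A⊆F fixed public

    GoodNear : Vtx n → ℕ → Set
    GoodNear u R = ∀ q → ∣ proj₁ q ∣ ℕ.+ ∣ proj₂ q ∣ ℕ.≤ R → GoodOrActive (u ⊕ q)

    GoodNear-≤ : ∀ {u R R'} → R ℕ.≤ R' → GoodNear u R' → GoodNear u R
    GoodNear-≤ R≤R' near q q≤R = near q (ℕP.≤-trans q≤R R≤R')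

    GoodNear-shift : ∀ u a R → GoodNear u (a ℕ.+ R) → ∀ s → ∣ proj₁ s ∣ ℕ.+ ∣ proj₂ s ∣ ℕ.≤ a → GoodNear (u ⊕ s) R
    GoodNear-shift u a R near (s₁ , s₂) s≤a (q₁ , q₂) q≤R =
      subst GoodOrActive (sym (⊕-assoc u (s₁ , s₂) (q₁ , q₂))) (near (s₁ + q₁ , s₂ + q₂) (begin
        ∣ s₁ + q₁ ∣ ℕ.+ ∣ s₂ + q₂ ∣                    ≤⟨ ℕP.+-mono-≤ (ℤP.∣i+j∣≤∣i∣+∣j∣ s₁ q₁) (ℤP.∣i+j∣≤∣i∣+∣j∣ s₂ q₂) ⟩
        (∣ s₁ ∣ ℕ.+ ∣ q₁ ∣) ℕ.+ (∣ s₂ ∣ ℕ.+ ∣ q₂ ∣)    ≡⟨ interchange (∣ s₁ ∣) (∣ q₁ ∣) (∣ s₂ ∣) (∣ q₂ ∣) ⟩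
        (∣ s₁ ∣ ℕ.+ ∣ s₂ ∣) ℕ.+ (∣ q₁ ∣ ℕ.+ ∣ q₂ ∣)    ≤⟨ ℕP.+-mono-≤ s≤a q≤R ⟩
        a ℕ.+ R ∎))
      where
      open ℕP.≤-Reasoning
      interchange : ∀ a b c d → (a ℕ.+ b) ℕ.+ (c ℕ.+ d) ≡ (a ℕ.+ c) ℕ.+ (b ℕ.+ d)
      interchange = solve-∀

    -- One sideways move needs good vertices within distance x₀ + 1 + T.
    reach : ℕ
    reach = suc (X 0) ℕ.+ T

    -- The translate moves one step sideways: the new points outside u + S are exactly the
    -- vertices just outside its rows, which are active by the boundary lemma.
    shift-sideways : ∀ σ u → SActive u → GoodNear u reach → SActive (u ⊕ (unit σ , + 0))
    shift-sideways σ u active near (x , y) (y≤T , x≤) =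
      trans (cong F (trans (⊕-assoc u (unit σ , + 0) (x , y)) (cong (λ z → u ⊕ (unit σ + x , z)) (ℤP.+-identityˡ y))))
            moved
      where
      moved : F (u ⊕ (unit σ + x , y)) ≡ true
      moved with ∣ unit σ + x ∣ ℕ.≤? X ∣ y ∣
      ... | yes inside = active (unit σ + x , y) (y≤T , inside)
      ... | no  out    = subst (λ z → F (u ⊕ (z , y)) ≡ true) (sym (step-out σ x (X ∣ y ∣) x≤ out))
          (beside-active σ u y y≤T active (near (outside σ (X ∣ y ∣) , y)
            (subst (λ z → z ℕ.+ ∣ y ∣ ℕ.≤ reach) (sym (HalfRows.∣outside∣ σ (X ∣ y ∣)))
              (ℕP.+-mono-≤ (s≤s (X-antitone z≤n y≤T)) y≤T))))

    slide-by : ∀ u → SActive u → GoodNear u (X 0 ℕ.+ reach) → ∀ σ s → s ℕ.≤ X 0 → SActive (u ⊕ (steps σ s , + 0))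
    slide-by u active near right zero    _   = subst SActive (sym (⊕-zero u)) active
    slide-by u active near left  zero    _   = subst SActive (sym (⊕-zero u)) active
    slide-by u active near σ     (suc s) s<X =
      subst SActive (trans (⊕-assoc u (steps σ s , + 0) (unit σ , + 0)) (cong (λ z → u ⊕ (z , + 0)) (steps-suc σ s)))
        (shift-sideways σ (u ⊕ (steps σ s , + 0)) (slide-by u active near σ s s≤X)
          (GoodNear-shift u (X 0) reach near (steps σ s , + 0)
            (subst (ℕ._≤ X 0) (sym (trans (ℕP.+-identityʳ _) (∣steps∣ σ s))) s≤X)))
      where s≤X = ℕP.<⇒≤ s<X

    slide : ∀ u → SActive u → GoodNear u (X 0 ℕ.+ reach) → ∀ x → ∣ x ∣ ℕ.≤ X 0 → SActive (u ⊕ (x , + 0))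
    slide u active near (+ s)     = slide-by u active near right s
    slide u active near -[1+ s ] = slide-by u active near left (suc s)

    slid-column : ∀ u → SActive u → GoodNear u (X 0 ℕ.+ reach) → ∀ z w → ∣ z ∣ ℕ.≤ X 0 → ∣ w ∣ ℕ.≤ T →
      F (u ⊕ (z , w)) ≡ true
    slid-column u active near z w z≤ w≤T =
      trans (cong F (sym (trans (⊕-assoc u (z , + 0) (+ 0 , w))
                                (cong₂ (λ a b → u ⊕ (a , b)) (ℤP.+-identityʳ z) (ℤP.+-identityˡ w)))))
            (slide u active near z z≤ (+ 0 , w) (w≤T , z≤n))

    -- The translate moves one step up or down: points staying within rows -T, …, T are
    -- covered by sliding, and the one new point, the apex (0, ±(T+1)), is activated
    -- because the row through the old apex is full.
    shift-vertical : ∀ u R → SActive u → GoodNear u (X 0 ℕ.+ reach) → SActive (u ⊕ (+ 0 , ρ R))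
    shift-vertical u R active near (x , y) (y≤T , x≤) =
      trans (cong F (trans (⊕-assoc u (+ 0 , ρ R) (x , y)) (cong (λ z → u ⊕ (z , ρ R + y)) (ℤP.+-identityˡ x)))) moved
      where
      column = slid-column u active near
      moved : F (u ⊕ (x , ρ R + y)) ≡ true
      moved with ∣ ρ R + y ∣ ℕ.≤? T
      ... | yes inside = column x (ρ R + y) (ℕP.≤-trans x≤ (X-antitone z≤n y≤T)) inside
      ... | no  out    = subst (λ z → F (u ⊕ (z , ρ R + y)) ≡ true) (sym x≡0)
                           (apex-active (u ⊕ (+ 0 , ρ R + y)) R full (near (+ 0 , ρ R + y) apex-near))
        where
        ∣ρ∣ : ∀ R → ∣ ρ R ∣ ≡ 1
        ∣ρ∣ above = refl
        ∣ρ∣ below = refl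
        one-row-out : ∣ ρ R + y ∣ ℕ.≤ suc ∣ y ∣
        one-row-out = ℕP.≤-trans (ℤP.∣i+j∣≤∣i∣+∣j∣ (ρ R) y) (ℕP.≤-reflexive (cong (ℕ._+ ∣ y ∣) (∣ρ∣ R)))
        y-top : ∣ y ∣ ≡ T
        y-top = ℕP.≤-antisym y≤T (ℕP.≤-pred (ℕP.≤-trans (ℕP.≰⇒> out) one-row-out))
        x≡0 : x ≡ + 0
        x≡0 = ℤP.∣i∣≡0⇒i≡0 (ℕP.n≤0⇒n≡0 (subst (∣ x ∣ ℕ.≤_) (trans (cong X y-top) X-top) x≤))
        full : ∀ z → ∣ z ∣ ℕ.≤ k → F ((u ⊕ (+ 0 , ρ R + y)) ⊕ (z , ρ (flip R))) ≡ true
        full z z≤k = trans (cong F (trans (⊕-assoc u (+ 0 , ρ R + y) (z , ρ (flip R)))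
                                          (cong₂ (λ a b → u ⊕ (a , b)) (ℤP.+-identityˡ z) (ρ-flip R y))))
                           (column z y (ℕP.≤-trans z≤k (k≤X z≤n)) y≤T)
        apex-near : ∣ + 0 ∣ ℕ.+ ∣ ρ R + y ∣ ℕ.≤ X 0 ℕ.+ reach
        apex-near = ℕP.≤-trans one-row-out (ℕP.≤-trans (s≤s (ℕP.≤-trans y≤T (ℕP.m≤n+m T (X 0)))) (ℕP.m≤n+m reach (X 0)))

    shift-along : ∀ u w → SActive u → GoodNear u (X 0 ℕ.+ reach) → Adj₁ u w → SActive w
    shift-along u w active near (inj₁ refl)               = shift-sideways right u active (GoodNear-≤ (ℕP.m≤n+m reach (X 0)) near)
    shift-along u w active near (inj₂ (inj₁ refl))        = shift-sideways left  u active (GoodNear-≤ (ℕP.m≤n+m reach (X 0)) near)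
    shift-along u w active near (inj₂ (inj₂ (inj₁ refl))) = shift-vertical u above active near
    shift-along u w active near (inj₂ (inj₂ (inj₂ refl))) = shift-vertical u below active near

    follow-walk : (U : Vtx n → Set) → (∀ u → U u → GoodNear u (X 0 ℕ.+ reach)) →
      ∀ {u v} → U u → SActive u → ConnIn U u v → SActive v
    follow-walk U near Uu active here                   = active
    follow-walk U near Uu active (there {w = w} uw Uw walk) =
      follow-walk U near Uw (shift-along _ w active (near _ Uu) uw) walk

    -- The radius used, x₀ + x₀ + 1 + T, is at most 32mk² (crudely: at most 6k²).
    radius≤ : X 0 ℕ.+ reach ℕ.≤ 32 ℕ.* m ℕ.* k ℕ.* k
    radius≤ = begin
        X 0 ℕ.+ (suc (X 0) ℕ.+ T)                   ≤⟨ ℕP.+-mono-≤ X₀≤2K (ℕP.+-mono-≤ (s≤s X₀≤2K) T≤K) ⟩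
        2 ℕ.* K ℕ.+ (suc (2 ℕ.* K) ℕ.+ K)            ≡⟨ collect K ⟩
        suc (5 ℕ.* K)                                ≤⟨ ℕP.+-monoˡ-≤ (5 ℕ.* K) 1≤K ⟩
        K ℕ.+ 5 ℕ.* K                                ≤⟨ ℕP.+-monoʳ-≤ K (ℕP.*-monoˡ-≤ K (ℕP.m≤m+n 5 26)) ⟩
        K ℕ.+ 31 ℕ.* K                               ≤⟨ ℕP.m≤n*m (K ℕ.+ 31 ℕ.* K) m ⟩
        m ℕ.* (K ℕ.+ 31 ℕ.* K)                       ≡⟨ reorder m k ⟩
        32 ℕ.* m ℕ.* k ℕ.* k ∎
      where
      open ℕP.≤-Reasoning
      K = k ℕ.* k
      1≤k : 1 ℕ.≤ k
      1≤k = ℕP.≤-trans (s≤s z≤n) m<k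
      1≤K : 1 ℕ.≤ K
      1≤K = ℕP.*-mono-≤ 1≤k 1≤k
      T≤k : T ℕ.≤ k
      T≤k = subst (ℕ._≤ k) (sym T≡) m<k
      T≤K : T ℕ.≤ K
      T≤K = ℕP.≤-trans T≤k (ℕP.m≤m*n k k {{ℕ.>-nonZero 1≤k}})
      X₀≤2K : X 0 ℕ.≤ 2 ℕ.* K
      X₀≤2K = ℕP.≤-trans X₀≤ (ℕP.≤-trans (ℕP.*-monoˡ-≤ (2 ℕ.* k) T≤k) (ℕP.≤-reflexive (twice k)))
        where twice : ∀ k → k ℕ.* (2 ℕ.* k) ≡ 2 ℕ.* (k ℕ.* k)
              twice = solve-∀
      collect : ∀ K → 2 ℕ.* K ℕ.+ (suc (2 ℕ.* K) ℕ.+ K) ≡ suc (5 ℕ.* K)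
      collect = solve-∀
      reorder : ∀ m k → m ℕ.* (k ℕ.* k ℕ.+ 31 ℕ.* (k ℕ.* k)) ≡ 32 ℕ.* m ℕ.* k ℕ.* k
      reorder = solve-∀

module Walks where

  open import Data.Nat as ℕ using (ℕ; zero; suc; NonZero; s≤s)
  import Data.Nat.Properties as ℕP
  open import Data.Integer as ℤ using (ℤ; +_; -[1+_]; _+_; -_; ∣_∣)
  import Data.Integer.Properties as ℤP
  open import Data.Product using (_×_; _,_; proj₁; proj₂)
  open import Data.Sum using (inj₁; inj₂)
  open import Relation.Binary.PropositionalEquality
  open import Defs
  open TorusArithmetic using (⊕-assoc; ⊕-zero)

  module _ {n : ℕ} .{{_ : NonZero n}} where

    near-weaken : ∀ {d d' u v} → Near {n} d u v → d ℕ.≤ d' → Near d' u v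
    near-weaken here          _        = here
    near-weaken (there uw wv) (s≤s le) = there uw (near-weaken wv le)

    near-trans : ∀ {a b u w v} → Near {n} a u w → Near b w v → Near (a ℕ.+ b) u v
    near-trans {a} {b} here nb = near-weaken nb (ℕP.m≤n+m b a)
    near-trans (there uw wv) nb = there uw (near-trans wv nb)

    near-repeat : ∀ d (f : ℕ → ℤ × ℤ) → (∀ u → Adj₁ u (u ⊕ d)) → f 0 ≡ (+ 0 , + 0) →
      (∀ a → d +² f a ≡ f (suc a)) → ∀ a (u : Vtx n) → Near a u (u ⊕ f a)
    near-repeat d f step f0 f-suc zero    u = subst (Near 0 u) (sym (trans (cong (u ⊕_) f0) (⊕-zero u))) here
    near-repeat d f step f0 f-suc (suc a) u = there (step u)
      (subst (Near a (u ⊕ d)) (trans (⊕-assoc u d (f a)) (cong (u ⊕_) (f-suc a))) (near-repeat d f step f0 f-suc a (u ⊕ d)))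

    near-horizontal : ∀ x (u : Vtx n) → Near ∣ x ∣ u (u ⊕ (x , + 0))
    near-horizontal (+ a)     = near-repeat (+ 1 , + 0) (λ a → + a , + 0) (λ u → inj₁ refl) refl (λ a → refl) a
    near-horizontal -[1+ a ] = near-repeat (- + 1 , + 0) (λ a → - + a , + 0) (λ u → inj₂ (inj₁ refl)) refl
      (λ a → cong (_, + 0) (sym (ℤP.neg-distrib-+ (+ 1) (+ a)))) (suc a)

    near-vertical : ∀ y (u : Vtx n) → Near ∣ y ∣ u (u ⊕ (+ 0 , y))
    near-vertical (+ a)     = near-repeat (+ 0 , + 1) (λ a → + 0 , + a) (λ u → inj₂ (inj₂ (inj₁ refl))) refl (λ a → refl) a
    near-vertical -[1+ a ] = near-repeat (+ 0 , - + 1) (λ a → + 0 , - + a) (λ u → inj₂ (inj₂ (inj₂ refl))) refl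
      (λ a → cong (+ 0 ,_) (sym (ℤP.neg-distrib-+ (+ 1) (+ a)))) (suc a)

    near-⊕ : ∀ (u : Vtx n) q → Near (∣ proj₁ q ∣ ℕ.+ ∣ proj₂ q ∣) u (u ⊕ q)
    near-⊕ u (x , y) = near-trans (near-horizontal x u)
      (subst (Near ∣ y ∣ (u ⊕ (x , + 0)))
        (trans (⊕-assoc u (x , + 0) (+ 0 , y)) (cong₂ (λ a b → u ⊕ (a , b)) (ℤP.+-identityʳ x) (ℤP.+-identityˡ y)))
        (near-vertical y (u ⊕ (x , + 0))))

open import Defs
open import Data.Nat using (ℕ; NonZero; _≤_; _<_; _+_; _*_; suc; z≤n)
open import Data.Integer using (ℤ; +_) renaming (_≤_ to _≤ℤ_)
open import Data.Bool using (true)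
open import Data.Product using (_×_; _,_; Σ; ∃; proj₁; proj₂)
open import Data.Sum using (_⊎_)
open import Relation.Binary.PropositionalEquality using (_≡_; sym; cong₂; subst)
import Data.Nat.Properties as ℕP
import Data.Integer.Properties as ℤP
open TorusArithmetic using (redV-⊕; ⊕-zero)
open Stabilisation using (stabilises; iter-inflationary)
open Walks using (near-weaken; near-⊕)
open Translation using (module Moves)

lemma2 : (n k m : ℕ) .{{_ : NonZero n}} (r : ℤ) →
    2 * k + 1 ≤ n → 1 ≤ m → m < k → r ≤ℤ + ceilDiv k m →
    (A : Config n) (U : Vtx n → Set) →
    L1Connected U →
    (∀ u v → U u → Near (32 * m * k * k) u v → Good k m A v ⊎ A v ≡ true) →
    (Σ (ℤ × ℤ) λ t → ∀ p → InS k m 0 0 p →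
    U (redV n (t +² p))
    × A (redV n (t +² p)) ≡ true) →
    ∃ λ t → ∀ v → U v → iter k r t A v ≡ true
lemma2 n k (suc m') r _ _ m<k r≤c A U connected good-near (t , S-active) = τ , U-active
  where
  τ = proj₁ (stabilises k r A)
  F = iter k r τ A
  open Moves k m' m<k r r≤c A F (iter-inflationary k r τ A) (proj₂ (stabilises k r A))
  U-good-near : ∀ u → U u → GoodNear u (X 0 + reach)
  U-good-near u Uu q q≤ = good-near u (u ⊕ q) Uu (near-weaken (near-⊕ u q) (ℕP.≤-trans q≤ radius≤))
  u₀ = redV n t
  U-u₀ : U u₀
  U-u₀ = subst (λ s → U (redV n s)) (cong₂ _,_ (ℤP.+-identityʳ (proj₁ t)) (ℤP.+-identityʳ (proj₂ t)))
           (proj₁ (S-active (+ 0 , + 0) (z≤n , z≤n)))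
  S-at-u₀ : SActive u₀
  S-at-u₀ p p∈S = subst (λ w → F w ≡ true) (sym (redV-⊕ n t p)) (iter-inflationary k r τ A _ (proj₂ (S-active p p∈S)))
  -- Walking from u₀ to any v ∈ U carries the active translate to v; in particular v is active.
  U-active : ∀ v → U v → F v ≡ true
  U-active v Uv = subst (λ w → F w ≡ true) (⊕-zero v)
    (follow-walk U U-good-near U-u₀ S-at-u₀ (connected u₀ v U-u₀ Uv) (+ 0 , + 0) (z≤n , z≤n))
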